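{- For every $k\geq1$ and every $n\geq1$, the families $\mathrm{SLT}_k$ and $\mathrm{RL}_n^P$ are incomparable, i.e. neither is a subset of the other.
   Context: A right-linear grammar is $(N,T,P,S)$ with rules of the form $A\to wB$ or $A\to w$, $A,B\in N$, $w\in T^*$; $\mathrm{RL}_n^P$ is the family of regular languages generated by some right-linear grammar with at most $n$ production rules. For $k\geq1$, a language $L$ over an alphabet $V$ is strictly locally $k$-testable (family $\mathrm{SLT}_k$) if there are sets $B,I,E\subseteq V^k$ and a finite set $F$ of words of length at most $k-1$ such that $L$ consists of the words of $F$ together with exactly those words $a_1a_2\cdots a_m$ ($m\geq k$, $a_i\in V$) for which $a_1\cdots a_k\in B$, $a_{j+1}\cdots a_{j+k}\in I$ for every $j$ with $1\leq j\leq m-k-1$, and $a_{m-k+1}\cdots a_m\in E$. -}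

module Defs where

open import Data.Nat using (ℕ; _≤_; _<_; _+_; _∸_)
open import Data.Fin using (Fin)
open import Data.List using (List; []; _∷_; _++_; length; take; drop)
open import Data.List.Membership.Propositional using (_∈_)
open import Data.Maybe using (Maybe; just; nothing)
open import Data.Bool using (Bool; true)
open import Data.Product using (Σ; _×_; _,_)
open import Data.Sum using (_⊎_)
open import Relation.Binary.PropositionalEquality using (_≡_)
open import Relation.Nullary using (¬_)

Language : ℕ → Set₁
Language m = List (Fin m) → Set

-- Right-linear grammar with finite nonterminal set Fin nN and terminal
-- alphabet Fin m.  A rule (A , w , just B) is A → wB, (A , w , nothing) is A → w.
Rule : ℕ → ℕ → Set
Rule nN m = Fin nN × List (Fin m) × Maybe (Fin nN)

record RLGrammar (m : ℕ) : Set where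
  field
    nN    : ℕ
    start : Fin nN
    rules : List (Rule nN m)

open RLGrammar public

data Derives {m : ℕ} (G : RLGrammar m) : Fin (nN G) → List (Fin m) → Set where
  term  : ∀ {A u} → (A , u , nothing) ∈ rules G → Derives G A u
  cont  : ∀ {A B u v} → (A , u , just B) ∈ rules G → Derives G B v →
          Derives G A (u ++ v)

Generates : ∀ {m} → RLGrammar m → Language m → Set
Generates G L = ∀ w → (L w → Derives G (start G) w) × (Derives G (start G) w → L w)

RL : (n : ℕ) → ∀ {m} → Language m → Set
RL n {m} L = Σ (RLGrammar m) λ G → length (rules G) ≤ n × Generates G L

factor : ∀ {m} → ℕ → ℕ → List (Fin m) → List (Fin m)
factor k j w = take k (drop j w)

-- SLT_k membership condition for words of length ≥ k, given B, I, E
-- (subsets of V^k, given as Boolean predicates; only their values on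
-- words of length k are ever consulted).
SLTCond : ∀ {m} → ℕ → (B I E : List (Fin m) → Bool) → List (Fin m) → Set
SLTCond k B I E w =
  k ≤ length w ×
  B (factor k 0 w) ≡ true ×
  (∀ j → 1 ≤ j → j + k + 1 ≤ length w → I (factor k j w) ≡ true) ×
  E (factor k (length w ∸ k) w) ≡ true

-- L ∈ SLT_k (over the alphabet Fin m).  F is a finite set of words of
-- length ≤ k-1 (only words of length < k are taken from F).
SLT : (k : ℕ) → ∀ {m} → Language m → Set
SLT k {m} L =
  Σ (List (Fin m) → Bool) λ B → Σ (List (Fin m) → Bool) λ I →
  Σ (List (Fin m) → Bool) λ E → Σ (List (Fin m) → Bool) λ F →
  ∀ w → (L w → ((length w < k × F w ≡ true) ⊎ SLTCond k B I E w))
      × (((length w < k × F w ≡ true) ⊎ SLTCond k B I E w) → L w)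

{-# OPTIONS --safe #-}
module Submission where

-- A right-linear grammar generating every one-letter word needs a rule with right-hand side a for each letter a, so over
-- an alphabet of n + 1 letters the universal language, which is trivially strictly locally testable, is not in RL_n^P.
-- Conversely the singleton language {a^(k+2)} is generated by one rule, but it is not in SLT_k: every factor of length
-- k of a^(k+2) is a^k, so the B, I, E tests that accept a^(k+2) accept every a^n with n ≥ k as well.

open import Defs
open import Data.Nat using (ℕ; zero; suc; _+_; _∸_; _≤_; _<_; s≤s; z≤n; _<?_)
open import Data.Nat.Properties
  using (≤-refl; ≤-trans; ≤-reflexive; ≤⇒≯; ≮⇒≥; 1+n≰n; <⇒≢; m≤n+m; m+n≤o⇒m≤o; m∸n+n≡m; +-comm)
open import Data.Fin using (Fin)
open import Data.Fin.Properties using (injective⇒≤)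
open import Data.List using (List; []; _∷_; length; take; replicate; lookup)
open import Data.List.Properties using (length-replicate; ∷-injectiveˡ)
open import Data.List.Relation.Unary.Any as Any using (Any; here; there; index)
open import Data.List.Relation.Unary.Any.Properties using (lookup-index)
open import Data.List.Membership.Propositional using (_∈_)
open import Data.Maybe using (nothing)
open import Data.Bool using (Bool; true)
open import Data.Unit using (⊤; tt)
open import Data.Empty using (⊥-elim)
open import Data.Product using (Σ; _×_; _,_; proj₁; proj₂)
open import Data.Sum using (_⊎_; inj₁; inj₂)
open import Relation.Nullary using (¬_; yes; no)
open import Relation.Binary.PropositionalEquality using (_≡_; refl; sym; cong; subst; subst₂; module ≡-Reasoning)

ruleWord : ∀ {nN m} → Rule nN m → List (Fin m)
ruleWord (_ , u , _) = u

module _ {m} (G : RLGrammar m) where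

  ∈rules⇒ruleWord : ∀ {r u} → r ∈ rules G → ruleWord r ≡ u → Any (λ r′ → ruleWord r′ ≡ u) (rules G)
  ∈rules⇒ruleWord r∈ r≡u = Any.map (λ { refl → r≡u }) r∈

  derives-letter⇒rule : ∀ {A w} {a : Fin m} → Derives G A w → w ≡ a ∷ [] →
                        Any (λ r → ruleWord r ≡ a ∷ []) (rules G)
  derives-letter⇒rule (term r∈) w≡a                         = ∈rules⇒ruleWord r∈ w≡a
  derives-letter⇒rule (cont {u = []} _ d) w≡a               = derives-letter⇒rule d w≡a
  derives-letter⇒rule (cont {u = _ ∷ []} {v = []} r∈ _) w≡a = ∈rules⇒ruleWord r∈ w≡a
  derives-letter⇒rule (cont {u = _ ∷ []} {v = _ ∷ _} _ _) ()
  derives-letter⇒rule (cont {u = _ ∷ _ ∷ _} _ _) ()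

  derives-letters⇒alphabet≤rules : (∀ a → Derives G (start G) (a ∷ [])) → m ≤ length (rules G)
  derives-letters⇒alphabet≤rules derives = injective⇒≤ {f = ruleOf} ruleOf-injective
    where
    ruleOf : Fin m → Fin (length (rules G))
    ruleOf a = index (derives-letter⇒rule (derives a) refl)

    ruleOf-word : ∀ a → ruleWord (lookup (rules G) (ruleOf a)) ≡ a ∷ []
    ruleOf-word a = lookup-index (derives-letter⇒rule (derives a) refl)

    ruleOf-injective : ∀ {a b} → ruleOf a ≡ ruleOf b → a ≡ b
    ruleOf-injective {a} {b} eq = ∷-injectiveˡ (begin
      a ∷ []                                  ≡⟨ ruleOf-word a ⟨
      ruleWord (lookup (rules G) (ruleOf a))  ≡⟨ cong (λ i → ruleWord (lookup (rules G) i)) eq ⟩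
      ruleWord (lookup (rules G) (ruleOf b))  ≡⟨ ruleOf-word b ⟩
      b ∷ []                                  ∎)
      where open ≡-Reasoning

RL⇒alphabet≤ : ∀ {n m} {L : Language m} → RL n L → (∀ a → L (a ∷ [])) → m ≤ n
RL⇒alphabet≤ (G , size , gen) letters =
  ≤-trans (derives-letters⇒alphabet≤rules G (λ a → proj₁ (gen (a ∷ [])) (letters a))) size

RL-mono : ∀ {n n′ m} {L : Language m} → n ≤ n′ → RL n L → RL n′ L
RL-mono n≤n′ (G , size , gen) = G , ≤-trans size n≤n′ , gen

singleton-RL : ∀ {m} (w : List (Fin m)) → RL 1 (_≡ w)
singleton-RL {m} w = G , ≤-refl , λ v → (λ { refl → term (here refl) }) , derives⇒≡w
  where
  G : RLGrammar m
  G = record { nN = 1 ; start = Fin.zero ; rules = (Fin.zero , w , nothing) ∷ [] }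

  derives⇒≡w : ∀ {v} → Derives G Fin.zero v → v ≡ w
  derives⇒≡w (term (here refl)) = refl
  derives⇒≡w (cont (there ()) _)

universal : ∀ {m} → Language m
universal _ = ⊤

universal-SLT : ∀ k {m} → SLT k (universal {m})
universal-SLT k = always , always , always , always , λ w → accepted w , λ _ → tt
  where
  always : ∀ {m} → List (Fin m) → Bool
  always _ = true

  accepted : ∀ {m} (w : List (Fin m)) → ⊤ → (length w < k × always w ≡ true) ⊎ SLTCond k always always always w
  accepted w _ with length w <? k
  ... | yes short = inj₁ (short , refl)
  ... | no ¬short = inj₂ (≮⇒≥ ¬short , refl , (λ _ _ _ → refl) , refl)

module _ {m} (a : Fin m) where

  take-replicate : ∀ {k n} → k ≤ n → take k (replicate n a) ≡ replicate k a
  take-replicate z≤n       = refl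
  take-replicate (s≤s k≤n) = cong (a ∷_) (take-replicate k≤n)

  factor-replicate : ∀ j {k n} → j + k ≤ n → factor k j (replicate n a) ≡ replicate k a
  factor-replicate zero    j+k≤n       = take-replicate j+k≤n
  factor-replicate (suc j) (s≤s j+k≤n) = factor-replicate j j+k≤n

  last-factor-replicate : ∀ {k n} → k ≤ n → factor k (length (replicate n a) ∸ k) (replicate n a) ≡ replicate k a
  last-factor-replicate {k} {n} k≤n rewrite length-replicate n {a} =
    factor-replicate (n ∸ k) (≤-reflexive (m∸n+n≡m k≤n))

  module _ {k : ℕ} (B I E : List (Fin m) → Bool) where

    -- Length 2 + k is what makes the inner test I fire at least once (at position 1).
    SLTCond-replicate⇒tests : ∀ {p} → 2 + k ≤ p → SLTCond k B I E (replicate p a) →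
      B (replicate k a) ≡ true × I (replicate k a) ≡ true × E (replicate k a) ≡ true
    SLTCond-replicate⇒tests {p} 2+k≤p (_ , first , inner , last) =
        subst (λ u → B u ≡ true) (take-replicate k≤p) first
      , subst (λ u → I u ≡ true) (factor-replicate 1 (≤-trans (m≤n+m (1 + k) 1) 2+k≤p)) (inner 1 ≤-refl 1+k+1≤length)
      , subst (λ u → E u ≡ true) (last-factor-replicate k≤p) last
      where
      k≤p : k ≤ p
      k≤p = ≤-trans (m≤n+m k 2) 2+k≤p

      1+k+1≤length : 1 + k + 1 ≤ length (replicate p a)
      1+k+1≤length = subst₂ _≤_ (cong suc (+-comm 1 k)) (sym (length-replicate p)) 2+k≤p

    tests⇒SLTCond-replicate : ∀ {n} → k ≤ n →
      B (replicate k a) ≡ true → I (replicate k a) ≡ true → E (replicate k a) ≡ true →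
      SLTCond k B I E (replicate n a)
    tests⇒SLTCond-replicate {n} k≤n first inner last =
        subst (k ≤_) (sym (length-replicate n)) k≤n
      , subst (λ u → B u ≡ true) (sym (take-replicate k≤n)) first
      , (λ j _ j+k+1≤length → subst (λ u → I u ≡ true) (sym (factor-replicate j (j+k≤n j+k+1≤length))) inner)
      , subst (λ u → E u ≡ true) (sym (last-factor-replicate k≤n)) last
      where
      j+k≤n : ∀ {j} → j + k + 1 ≤ length (replicate n a) → j + k ≤ n
      j+k≤n {j} le = m+n≤o⇒m≤o (j + k) (subst (j + k + 1 ≤_) (length-replicate n) le)

  SLT-replicate-upward-closed : ∀ {k p n} {L : Language m} → SLT k L → 2 + k ≤ p →
                                L (replicate p a) → k ≤ n → L (replicate n a)
  SLT-replicate-upward-closed {k} {p} {n} (B , I , E , _ , iff) 2+k≤p Lp k≤n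
    with proj₁ (iff (replicate p a)) Lp
  ... | inj₁ (short , _) =
    ⊥-elim (≤⇒≯ (≤-trans (m≤n+m k 2) 2+k≤p) (subst (_< k) (length-replicate p) short))
  ... | inj₂ cond with SLTCond-replicate⇒tests B I E 2+k≤p cond
  ...   | first , inner , last =
    proj₂ (iff (replicate n a)) (inj₂ (tests⇒SLTCond-replicate B I E k≤n first inner last))

  ¬SLT-singleton-replicate : ∀ k → ¬ SLT k (_≡ replicate (2 + k) a)
  ¬SLT-singleton-replicate k slt =
    <⇒≢ ≤-refl (sym (cong length (SLT-replicate-upward-closed slt ≤-refl refl (m≤n+m k 3))))

-- The constructions work for k = 0 as well.
lemma13 : (k n : ℕ) → 1 ≤ k → 1 ≤ n →
    (Σ ℕ λ m → Σ (Language m) λ L → SLT k L × ¬ RL n L)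
    × (Σ ℕ λ m → Σ (Language m) λ L → RL n L × ¬ SLT k L)
lemma13 k n _ 1≤n =
    (suc n , universal , universal-SLT k , λ rl → 1+n≰n (RL⇒alphabet≤ rl (λ _ → tt)))
  , (1 , (_≡ replicate (2 + k) Fin.zero) , RL-mono 1≤n (singleton-RL _) , ¬SLT-singleton-replicate Fin.zero k)
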